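{- Let $\alpha,\beta,q$ be nonzero parameters (indeterminates). Let $D_1=(d_{ij})_{i,j\ge 1}$ be the infinite matrix with $d_{i,i+1}=\beta^{ -1}$ for all $i\ge 1$ and $d_{ij}=0$ for $j\neq i+1$. Let $E_1=(e_{ij})_{i,j\ge1}$ be the infinite lower triangular matrix with $$e_{ij}=\beta^{i-j}\Big(\alpha^{ -1}q^{j-1}\binom{i-1}{j-1}+\sum_{r=0}^{j-2}\binom{i-j+r}{r}q^r\Big)\quad (j\le i),\qquad e_{ij}=0\quad (j>i).$$ Let $W_1=(1,0,0,\dots)$ (row vector) and $V_1=(1,1,1,\dots)^T$ (column vector). Then $$D_1E_1-qE_1D_1=D_1+E_1,\qquad D_1V_1=\tfrac{1}{\beta}V_1,\qquad W_1E_1=\tfrac{1}{\alpha}W_1.$$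
   Context: All matrix products involved are well defined, since every row of $D_1$ and of $E_1$ has only finitely many nonzero entries. -}

module Defs where

open import Level using (Level)
open import Algebra.Bundles using (CommutativeRing)
import Algebra.Bundles
open import Data.Nat using (ℕ; zero; suc; _∸_; _≤?_; _≟_; _<_)
open import Data.Nat.Combinatorics using (_C_)
open import Data.Bool using (if_then_else_)
open import Relation.Nullary.Decidable using (⌊_⌋)

-- Infinite matrices / vectors over a commutative ring R, indexed 1-based by ℕ
-- (entries at index 0 are never used).
module Matrices {c ℓ : Level} (R : CommutativeRing c ℓ) where
  open CommutativeRing R renaming (Carrier to A)
  open import Algebra.Definitions.RawSemiring (Algebra.Bundles.Semiring.rawSemiring semiring) using (_^_; _×_)

  Mat : Set c
  Mat = ℕ → ℕ → A

  Vect : Set c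
  Vect = ℕ → A

  sum0 : ℕ → (ℕ → A) → A
  sum0 zero    f = 0#
  sum0 (suc n) f = sum0 n f + f n

  sum1 : ℕ → (ℕ → A) → A
  sum1 n f = sum0 n (λ k → f (suc k))

  binom : ℕ → ℕ → A
  binom n k = (n C k) × 1#

  RowBound : Mat → (ℕ → ℕ) → Set ℓ
  RowBound M s = ∀ i k → s i < k → M i k ≈ 0#

  VecBound : Vect → ℕ → Set ℓ
  VecBound w n = ∀ k → n < k → w k ≈ 0#

  -- product of a row-finite matrix M (row support bounded by s) with any matrix N
  mulRF : Mat → (ℕ → ℕ) → Mat → Mat
  mulRF M s N i j = sum1 (s i) (λ k → M i k * N k j)

  mulMV : Mat → (ℕ → ℕ) → Vect → Vect
  mulMV M s v i = sum1 (s i) (λ k → M i k * v k)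

  mulVM : Vect → ℕ → Mat → Vect
  mulVM w n M j = sum1 n (λ k → w k * M k j)

  module Paper (αinv β βinv q : A) where
    D₁ : Mat
    D₁ i j = if ⌊ j ≟ suc i ⌋ then βinv else 0#

    sD : ℕ → ℕ
    sD i = suc i

    E₁ : Mat
    E₁ i j = if ⌊ j ≤? i ⌋
               then (β ^ (i ∸ j)) * ((αinv * (q ^ (j ∸ 1))) * binom (i ∸ 1) (j ∸ 1)
                                      + sum0 (j ∸ 1) (λ r → binom ((i ∸ j) Data.Nat.+ r) r * (q ^ r)))
               else 0#

    sE : ℕ → ℕ
    sE i = i

    W₁ : Vect
    W₁ k = if ⌊ k ≟ 1 ⌋ then 1# else 0#

    V₁ : Vect
    V₁ k = 1#

{-# OPTIONS --safe #-}
-- Write e_{ij} = β^(i-j) c(i-j, j-1) with c(d,k) = α⁻¹ q^k C(d+k,k) + Σ_{r<k} C(d+r,r) q^r.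
-- Multiplying by D₁ on the left shifts rows, (D₁M)_{ij} = β⁻¹ m_{i+1,j}, and on the right
-- shifts columns, (ED₁)_{ij} = β⁻¹ e_{i,j-1}.  On and below the diagonal the commutation
-- relation thus becomes c(d+1,k+1) = c(d,k+1) + q c(d+1,k): Pascal's rule, applied to the
-- α⁻¹-term and termwise to the sum.  On the superdiagonal it becomes the geometric-series
-- recurrence c(0,k+1) = 1 + q c(0,k), whose constant term 1 produces the entry β⁻¹ of D₁.
module Submission where

open import Defs
open import Level using (Level)
open import Algebra.Bundles using (CommutativeRing)
import Algebra.Bundles
open import Data.Nat as ℕ
  using (ℕ; zero; suc; _≤_; _<_; _<?_; _≟_; _≤?_; s≤s; z≤n; Ordering; less; equal; greater; compare)
open import Data.Nat.Properties
  using ( ≤-refl; m<n⇒m<1+n; m<1+n⇒m<n∨m≡n; <-irrefl; <⇒≢; <⇒≱; ≮⇒≥; suc-injective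
        ; m+n∸n≡m; m≤m+n; m≤n⇒m≤1+n; m≢1+m+n; n<1+n)
import Data.Nat.Properties as ℕₚ
open import Data.Product using (_×_; _,_)
open import Data.Nat.Combinatorics using (_C_; nCk+nC[k+1]≡[n+1]C[k+1]; nCn≡1)
open import Data.Sum using (inj₁; inj₂)
open import Function using (_∘_)
open import Relation.Nullary using (¬_; Dec; yes; no; contradiction)
open import Relation.Binary.PropositionalEquality using (_≡_; _≢_; refl; sym; cong)

module _ {c ℓ : Level} (R : CommutativeRing c ℓ) where
  open CommutativeRing R renaming (Carrier to A; refl to ≈-refl; sym to ≈-sym; trans to ≈-trans)
  open Matrices R
  open import Algebra.Definitions.RawSemiring (Algebra.Bundles.Semiring.rawSemiring semiring) using (_^_)
  open import Algebra.Properties.Semiring.Mult semiring using (×-homo-+)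
  open import Algebra.Solver.Ring.NaturalCoefficients.Default commutativeSemiring using (solve; _:+_; _:*_; _:=_)
  open import Relation.Binary.Reasoning.Setoid setoid

  x≈z+y⇒x-y≈z : ∀ {x y z} → x ≈ z + y → x - y ≈ z
  x≈z+y⇒x-y≈z {x} {y} {z} x≈z+y = begin
    x - y        ≈⟨ +-congʳ x≈z+y ⟩
    z + y - y    ≈⟨ +-assoc z y (- y) ⟩
    z + (y - y)  ≈⟨ +-congˡ (-‿inverseʳ y) ⟩
    z + 0#       ≈⟨ +-identityʳ z ⟩
    z            ∎

  sum0-zero : ∀ n {f : ℕ → A} → (∀ k → k < n → f k ≈ 0#) → sum0 n f ≈ 0#
  sum0-zero zero    _   = ≈-refl
  sum0-zero (suc n) f≈0 =
    ≈-trans (+-cong (sum0-zero n (λ k k<n → f≈0 k (m<n⇒m<1+n k<n))) (f≈0 n ≤-refl)) (+-identityʳ 0#)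

  sum0-single : ∀ n {m} {f : ℕ → A} → m < n → (∀ k → k ≢ m → f k ≈ 0#) → sum0 n f ≈ f m
  sum0-single (suc n) {m} {f} m<1+n f≈0 with m<1+n⇒m<n∨m≡n m<1+n
  ... | inj₁ m<n  = ≈-trans (+-cong (sum0-single n m<n f≈0) (f≈0 n (λ n≡m → <-irrefl (sym n≡m) m<n)))
                            (+-identityʳ (f m))
  ... | inj₂ refl = ≈-trans (+-congʳ (sum0-zero n (λ k k<n → f≈0 k (<⇒≢ k<n)))) (+-identityˡ (f n))

  binom-pascal : ∀ n k → binom (suc n) (suc k) ≈ binom n k + binom n (suc k)
  binom-pascal n k rewrite sym (nCk+nC[k+1]≡[n+1]C[k+1] n k) = ×-homo-+ 1# (n C k) (n C suc k)

  binom-diag : ∀ n → binom n n ≈ 1#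
  binom-diag n rewrite nCn≡1 n = +-identityʳ 1#

  module _ (q : A) where

    binomSum : ℕ → ℕ → A
    binomSum d k = sum0 k (λ r → binom (d ℕ.+ r) r * q ^ r)

    binomSum-pascal : ∀ d k → binomSum (suc d) (suc k) ≈ binomSum d (suc k) + q * binomSum (suc d) k
    binomSum-pascal d zero    = ≈-sym (≈-trans (+-congˡ (zeroʳ q)) (+-identityʳ _))
    binomSum-pascal d (suc k) = begin
      binomSum (suc d) (suc k) + binom (suc d ℕ.+ suc k) (suc k) * (q * q ^ k)
        ≈⟨ +-cong (binomSum-pascal d k) (*-congʳ (binom-pascal (d ℕ.+ suc k) k)) ⟩
      (S + q * T) + (binom (d ℕ.+ suc k) k + B) * (q * q ^ k)
        ≡⟨ cong (λ n → (S + q * T) + (binom n k + B) * (q * q ^ k)) (ℕₚ.+-suc d k) ⟩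
      (S + q * T) + (binom (suc d ℕ.+ k) k + B) * (q * q ^ k)
        ≈⟨ solve 6 (λ S T q Q B′ B → (S :+ q :* T) :+ (B′ :+ B) :* (q :* Q)
                                  := (S :+ B :* (q :* Q)) :+ q :* (T :+ B′ :* Q))
                   ≈-refl S T q (q ^ k) (binom (suc d ℕ.+ k) k) B ⟩
      binomSum d (suc (suc k)) + q * binomSum (suc d) (suc k) ∎
      where
        S = binomSum d (suc k)
        T = binomSum (suc d) k
        B = binom (d ℕ.+ suc k) (suc k)

    binomSum-diag : ∀ k → binomSum 0 (suc k) ≈ 1# + q * binomSum 0 k
    binomSum-diag zero = begin
      0# + binom 0 0 * 1#  ≈⟨ +-identityˡ _ ⟩
      binom 0 0 * 1#       ≈⟨ *-identityʳ _ ⟩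
      binom 0 0            ≈⟨ binom-diag 0 ⟩
      1#                   ≈⟨ +-identityʳ 1# ⟨
      1# + 0#              ≈⟨ +-congˡ (zeroʳ q) ⟨
      1# + q * 0#          ∎
    binomSum-diag (suc k) = begin
      binomSum 0 (suc k) + binom (suc k) (suc k) * (q * q ^ k)
        ≈⟨ +-cong (binomSum-diag k) (*-congʳ (binom-diag (suc k))) ⟩
      (1# + q * binomSum 0 k) + 1# * (q * q ^ k)
        ≈⟨ solve 4 (λ o q S Q → (o :+ q :* S) :+ o :* (q :* Q) := o :+ q :* (S :+ o :* Q))
                   ≈-refl 1# q (binomSum 0 k) (q ^ k) ⟩
      1# + q * (binomSum 0 k + 1# * q ^ k)
        ≈⟨ +-congˡ (*-congˡ (+-congˡ (*-congʳ (binom-diag k)))) ⟨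
      1# + q * binomSum 0 (suc k) ∎

  module _ (αinv q : A) where

    coeff : ℕ → ℕ → A
    coeff d k = αinv * q ^ k * binom (d ℕ.+ k) k + binomSum q d k

    coeff-pascal : ∀ d k → coeff (suc d) (suc k) ≈ coeff d (suc k) + q * coeff (suc d) k
    coeff-pascal d k = begin
      αinv * (q * q ^ k) * binom (suc d ℕ.+ suc k) (suc k) + binomSum q (suc d) (suc k)
        ≈⟨ +-cong (*-congˡ (binom-pascal (d ℕ.+ suc k) k)) (binomSum-pascal q d k) ⟩
      αinv * (q * q ^ k) * (binom (d ℕ.+ suc k) k + B) + (S + q * T)
        ≡⟨ cong (λ n → αinv * (q * q ^ k) * (binom n k + B) + (S + q * T)) (ℕₚ.+-suc d k) ⟩
      αinv * (q * q ^ k) * (binom (suc d ℕ.+ k) k + B) + (S + q * T)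
        ≈⟨ solve 7 (λ a q Q B′ B S T → a :* (q :* Q) :* (B′ :+ B) :+ (S :+ q :* T)
                                    := (a :* (q :* Q) :* B :+ S) :+ q :* (a :* Q :* B′ :+ T))
                   ≈-refl αinv q (q ^ k) (binom (suc d ℕ.+ k) k) B S T ⟩
      coeff d (suc k) + q * coeff (suc d) k ∎
      where
        B = binom (d ℕ.+ suc k) (suc k)
        S = binomSum q d (suc k)
        T = binomSum q (suc d) k

    coeff-diag : ∀ k → coeff 0 (suc k) ≈ 1# + q * coeff 0 k
    coeff-diag k = begin
      αinv * (q * q ^ k) * binom (suc k) (suc k) + binomSum q 0 (suc k)
        ≈⟨ +-cong (*-congˡ (binom-diag (suc k))) (binomSum-diag q k) ⟩
      αinv * (q * q ^ k) * 1# + (1# + q * binomSum q 0 k)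
        ≈⟨ solve 5 (λ a q Q o S → a :* (q :* Q) :* o :+ (o :+ q :* S) := o :+ q :* (a :* Q :* o :+ S))
                   ≈-refl αinv q (q ^ k) 1# (binomSum q 0 k) ⟩
      1# + q * (αinv * q ^ k * 1# + binomSum q 0 k)
        ≈⟨ +-congˡ (*-congˡ (+-congʳ (*-congˡ (binom-diag k)))) ⟨
      1# + q * coeff 0 k ∎

  module PaperMatrices (αinv β βinv q : A) where
    open Paper αinv β βinv q public

    e : ℕ → ℕ → A
    e d k = β ^ d * coeff αinv q d k

    e-diag : ∀ k → βinv * e 0 (suc k) ≈ βinv + q * (e 0 k * βinv)
    e-diag k = begin
      βinv * (1# * coeff αinv q 0 (suc k))  ≈⟨ *-congˡ (*-identityˡ _) ⟩
      βinv * coeff αinv q 0 (suc k)         ≈⟨ *-congˡ (coeff-diag αinv q k) ⟩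
      βinv * (1# + q * x)                   ≈⟨ solve 4 (λ b′ o q c → b′ :* (o :+ q :* c) := b′ :* o :+ q :* (c :* b′))
                                                       ≈-refl βinv 1# q x ⟩
      βinv * 1# + q * (x * βinv)            ≈⟨ +-cong (*-identityʳ βinv) (*-congˡ (*-congʳ (≈-sym (*-identityˡ x)))) ⟩
      βinv + q * (e 0 k * βinv)             ∎
      where x = coeff αinv q 0 k

    D₁-superdiagonal : ∀ i → D₁ i (suc i) ≈ βinv
    D₁-superdiagonal i with suc i ≟ suc i
    ... | yes _    = ≈-refl
    ... | no i≢i   = contradiction refl i≢i

    D₁-off : ∀ {i j} → j ≢ suc i → D₁ i j ≈ 0#
    D₁-off {i} {j} j≢1+i with j ≟ suc i
    ... | yes j≡1+i = contradiction j≡1+i j≢1+i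
    ... | no _      = ≈-refl

    E₁-entry : ∀ {i} d k → suc (k ℕ.+ d) ≡ i → E₁ i (suc k) ≈ e d k
    E₁-entry d k refl with suc k ≤? suc (k ℕ.+ d)
    ... | yes _ rewrite ℕₚ.+-comm k d | m+n∸n≡m d k = ≈-refl
    ... | no k≰k+d = contradiction (s≤s (m≤m+n k d)) k≰k+d

    E₁-diagonal : ∀ k → E₁ (suc k) (suc k) ≈ e 0 k
    E₁-diagonal k = E₁-entry 0 k (cong suc (ℕₚ.+-identityʳ k))

    E₁-upper : ∀ {i j} → i < j → E₁ i j ≈ 0#
    E₁-upper {i} {j} i<j with j ≤? i
    ... | yes j≤i = contradiction j≤i (<⇒≱ i<j)
    ... | no _    = ≈-refl

    W₁-off : ∀ {k} → k ≢ 1 → W₁ k ≈ 0#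
    W₁-off {k} k≢1 with k ≟ 1
    ... | yes k≡1 = contradiction k≡1 k≢1
    ... | no _    = ≈-refl

    D₁-rowBound : RowBound D₁ sD
    D₁-rowBound i k 1+i<k = D₁-off (λ k≡1+i → <⇒≢ 1+i<k (sym k≡1+i))

    E₁-rowBound : RowBound E₁ sE
    E₁-rowBound i k i<k = E₁-upper i<k

    W₁-bound : VecBound W₁ 1
    W₁-bound k 1<k = W₁-off (λ k≡1 → <⇒≢ 1<k (sym k≡1))

    D₁-mulˡ : ∀ (M : Mat) i j → mulRF D₁ sD M i j ≈ βinv * M (suc i) j
    D₁-mulˡ M i j =
      ≈-trans (sum0-single (suc i) ≤-refl
                (λ k k≢i → ≈-trans (*-congʳ (D₁-off (k≢i ∘ suc-injective))) (zeroˡ _)))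
              (*-congʳ (D₁-superdiagonal i))

    D₁-mulᵛ : ∀ (v : Vect) i → mulMV D₁ sD v i ≈ βinv * v (suc i)
    D₁-mulᵛ v i = D₁-mulˡ (λ k _ → v k) i 0

    D₁-mulʳ-first-column : ∀ (M : Mat) s i → mulRF M s D₁ i 1 ≈ 0#
    D₁-mulʳ-first-column M s i = sum0-zero (s i) (λ k _ → ≈-trans (*-congˡ (D₁-off {suc k} {1} (λ ()))) (zeroʳ _))

    D₁-mulʳ : ∀ (M : Mat) s → RowBound M s → ∀ i j → mulRF M s D₁ i (suc (suc j)) ≈ M i (suc j) * βinv
    D₁-mulʳ M s M-bound i j = by-cases (j <? s i)
      where
        term≈0 : ∀ k → k ≢ j → M i (suc k) * D₁ (suc k) (suc (suc j)) ≈ 0#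
        term≈0 k k≢j = ≈-trans (*-congˡ (D₁-off (k≢j ∘ sym ∘ suc-injective ∘ suc-injective))) (zeroʳ _)

        by-cases : Dec (j < s i) → mulRF M s D₁ i (suc (suc j)) ≈ M i (suc j) * βinv
        by-cases (yes j<s) = ≈-trans (sum0-single (s i) j<s term≈0) (*-congˡ (D₁-superdiagonal (suc j)))
        by-cases (no j≮s)  = begin
          mulRF M s D₁ i (suc (suc j)) ≈⟨ sum0-zero (s i) (λ k k<s → term≈0 k (λ { refl → j≮s k<s })) ⟩
          0#                           ≈⟨ zeroˡ βinv ⟨
          0# * βinv                    ≈⟨ *-congʳ (M-bound i (suc j) (s≤s (≮⇒≥ j≮s))) ⟨
          M i (suc j) * βinv           ∎

    W₁-mulˡ : ∀ (M : Mat) j → mulVM W₁ 1 M j ≈ M 1 j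
    W₁-mulˡ M j = ≈-trans (+-identityˡ _) (*-identityˡ _)

    E₁-first-row : ∀ j → 1 ≤ j → E₁ 1 j ≈ αinv * W₁ j
    E₁-first-row (suc zero) _ = begin
      E₁ 1 1                              ≈⟨ E₁-diagonal 0 ⟩
      1# * (αinv * 1# * binom 0 0 + 0#)   ≈⟨ *-identityˡ _ ⟩
      αinv * 1# * binom 0 0 + 0#          ≈⟨ +-identityʳ _ ⟩
      αinv * 1# * binom 0 0               ≈⟨ *-congˡ (binom-diag 0) ⟩
      αinv * 1# * 1#                      ≈⟨ *-identityʳ _ ⟩
      αinv * 1#                           ∎
    E₁-first-row (suc (suc j)) _ =
      ≈-trans (E₁-upper {1} {suc (suc j)} (s≤s (s≤s z≤n))) (≈-sym (zeroʳ αinv))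

    module _ (ββinv : β * βinv ≈ 1#) where

      βinv-cancelˡ : ∀ x y → βinv * ((β * x) * y) ≈ x * y
      βinv-cancelˡ x y = begin
        βinv * ((β * x) * y) ≈⟨ solve 4 (λ b b′ x y → b′ :* ((b :* x) :* y) := (b :* b′) :* (x :* y))
                                        ≈-refl β βinv x y ⟩
        (β * βinv) * (x * y) ≈⟨ *-congʳ ββinv ⟩
        1# * (x * y)         ≈⟨ *-identityˡ (x * y) ⟩
        x * y                ∎

      βinv-cancelʳ : ∀ x y → ((β * x) * y) * βinv ≈ x * y
      βinv-cancelʳ x y = ≈-trans (*-comm _ βinv) (βinv-cancelˡ x y)

      e-first-column : ∀ d → βinv * e (suc d) 0 ≈ e d 0
      e-first-column d = βinv-cancelˡ (β ^ d) (coeff αinv q d 0)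

      e-pascal : ∀ d k → βinv * e (suc d) (suc k) ≈ e d (suc k) + q * (e (suc d) k * βinv)
      e-pascal d k = begin
        βinv * e (suc d) (suc k)
          ≈⟨ βinv-cancelˡ (β ^ d) _ ⟩
        β ^ d * coeff αinv q (suc d) (suc k)
          ≈⟨ *-congˡ (coeff-pascal αinv q d k) ⟩
        β ^ d * (coeff αinv q d (suc k) + q * coeff αinv q (suc d) k)
          ≈⟨ solve 4 (λ x c q c′ → x :* (c :+ q :* c′) := x :* c :+ q :* (x :* c′))
                     ≈-refl (β ^ d) (coeff αinv q d (suc k)) q (coeff αinv q (suc d) k) ⟩
        e d (suc k) + q * (β ^ d * coeff αinv q (suc d) k)
          ≈⟨ +-congˡ (*-congˡ (βinv-cancelʳ (β ^ d) _)) ⟨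
        e d (suc k) + q * (e (suc d) k * βinv) ∎

      E₁-recurrence-first-column : ∀ a → βinv * E₁ (suc (suc a)) 1 ≈ E₁ (suc a) 1
      E₁-recurrence-first-column a = begin
        βinv * E₁ (suc (suc a)) 1  ≈⟨ *-congˡ (E₁-entry (suc a) 0 refl) ⟩
        βinv * e (suc a) 0         ≈⟨ e-first-column a ⟩
        e a 0                      ≈⟨ E₁-entry a 0 refl ⟨
        E₁ (suc a) 1               ∎

      E₁-recurrence : ∀ a c → Ordering c a →
        βinv * E₁ (suc (suc a)) (suc (suc c))
          ≈ (D₁ (suc a) (suc (suc c)) + E₁ (suc a) (suc (suc c))) + q * (E₁ (suc a) (suc c) * βinv)
      E₁-recurrence _ c (less _ d) = begin
        βinv * E₁ (suc (suc (suc (c ℕ.+ d)))) (suc (suc c))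
          ≈⟨ *-congˡ (E₁-entry (suc d) (suc c) (cong (suc ∘ suc) (ℕₚ.+-suc c d))) ⟩
        βinv * e (suc d) (suc c)
          ≈⟨ e-pascal d c ⟩
        e d (suc c) + q * (e (suc d) c * βinv)
          ≈⟨ +-cong (E₁-entry d (suc c) refl)
                    (*-congˡ (*-congʳ (E₁-entry (suc d) c (cong suc (ℕₚ.+-suc c d))))) ⟨
        E₁ i (suc (suc c)) + q * (E₁ i (suc c) * βinv)
          ≈⟨ +-congʳ (≈-trans (+-congʳ D₁≈0) (+-identityˡ _)) ⟨
        (D₁ i (suc (suc c)) + E₁ i (suc (suc c))) + q * (E₁ i (suc c) * βinv) ∎
        where
          i = suc (suc (c ℕ.+ d))
          D₁≈0 : D₁ i (suc (suc c)) ≈ 0#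
          D₁≈0 = D₁-off (m≢1+m+n c ∘ suc-injective ∘ suc-injective)
      E₁-recurrence a _ (equal _) = begin
        βinv * E₁ (suc (suc a)) (suc (suc a))  ≈⟨ *-congˡ (E₁-diagonal (suc a)) ⟩
        βinv * e 0 (suc a)                     ≈⟨ e-diag a ⟩
        βinv + q * (e 0 a * βinv)              ≈⟨ +-cong D₁+E₁≈βinv (*-congˡ (*-congʳ (E₁-diagonal a))) ⟨
        (D₁ (suc a) (suc (suc a)) + E₁ (suc a) (suc (suc a))) + q * (E₁ (suc a) (suc a) * βinv) ∎
        where
          D₁+E₁≈βinv : D₁ (suc a) (suc (suc a)) + E₁ (suc a) (suc (suc a)) ≈ βinv
          D₁+E₁≈βinv = ≈-trans (+-cong (D₁-superdiagonal (suc a)) (E₁-upper (n<1+n (suc a)))) (+-identityʳ βinv)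
      E₁-recurrence a _ (greater _ k) = begin
        βinv * E₁ (suc (suc a)) j                  ≈⟨ *-congˡ (E₁-upper (s≤s (s≤s (s≤s (m≤m+n a k))))) ⟩
        βinv * 0#                                  ≈⟨ zeroʳ βinv ⟩
        0#                                         ≈⟨ 0≈0+0+q*[0*βinv] ⟩
        (0# + 0#) + q * (0# * βinv)                ≈⟨ +-cong (+-cong D₁≈0 (E₁-upper (s≤s (s≤s (m≤n⇒m≤1+n (m≤m+n a k))))))
                                                             (*-congˡ (*-congʳ (E₁-upper (s≤s (s≤s (m≤m+n a k)))))) ⟨
        (D₁ (suc a) j + E₁ (suc a) j) + q * (E₁ (suc a) (suc (suc (a ℕ.+ k))) * βinv) ∎
        where
          j = suc (suc (suc (a ℕ.+ k)))
          D₁≈0 : D₁ (suc a) j ≈ 0#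
          D₁≈0 = D₁-off (m≢1+m+n a ∘ sym ∘ suc-injective ∘ suc-injective)
          0≈0+0+q*[0*βinv] : 0# ≈ (0# + 0#) + q * (0# * βinv)
          0≈0+0+q*[0*βinv] = ≈-sym (≈-trans (+-cong (+-identityʳ 0#) (≈-trans (*-congˡ (zeroˡ βinv)) (zeroʳ q)))
                                            (+-identityʳ 0#))

      commutation : ∀ i j → 1 ≤ i → 1 ≤ j →
        mulRF D₁ sD E₁ i j - q * mulRF E₁ sE D₁ i j ≈ D₁ i j + E₁ i j
      commutation (suc a) (suc b) _ _ = x≈z+y⇒x-y≈z (≈-trans (D₁-mulˡ E₁ (suc a) (suc b)) (shifted b))
        where
          shifted : ∀ b → βinv * E₁ (suc (suc a)) (suc b)
                          ≈ (D₁ (suc a) (suc b) + E₁ (suc a) (suc b)) + q * mulRF E₁ sE D₁ (suc a) (suc b)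
          shifted zero = begin
            βinv * E₁ (suc (suc a)) 1
              ≈⟨ E₁-recurrence-first-column a ⟩
            E₁ (suc a) 1
              ≈⟨ +-identityʳ _ ⟨
            E₁ (suc a) 1 + 0#
              ≈⟨ +-cong (+-identityˡ _) (zeroʳ q) ⟨
            (0# + E₁ (suc a) 1) + q * 0#
              ≈⟨ +-cong (+-congʳ (D₁-off {suc a} {1} (λ ())))
                        (*-congˡ (D₁-mulʳ-first-column E₁ sE (suc a))) ⟨
            (D₁ (suc a) 1 + E₁ (suc a) 1) + q * mulRF E₁ sE D₁ (suc a) 1 ∎
          shifted (suc c) = ≈-trans (E₁-recurrence a c (compare c a))
                                    (+-congˡ (*-congˡ (≈-sym (D₁-mulʳ E₁ sE E₁-rowBound (suc a) c))))

lemma2p5 : {c ℓ : Level} (R : CommutativeRing c ℓ) →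
    let open CommutativeRing R in
    (α αinv β βinv q : Carrier) →
    α * αinv ≈ 1# → β * βinv ≈ 1# → ¬ (q ≈ 0#) →
    let open Matrices R in
    let open Paper αinv β βinv q in
    RowBound D₁ sD × RowBound E₁ sE × VecBound W₁ 1 ×
    (∀ (i j : ℕ) → 1 ≤ i → 1 ≤ j →
      mulRF D₁ sD E₁ i j - q * mulRF E₁ sE D₁ i j ≈ D₁ i j + E₁ i j) ×
    (∀ (i : ℕ) → 1 ≤ i → mulMV D₁ sD V₁ i ≈ βinv * V₁ i) ×
    (∀ (j : ℕ) → 1 ≤ j → mulVM W₁ 1 E₁ j ≈ αinv * W₁ j)
lemma2p5 R α αinv β βinv q _ ββinv _ =
    D₁-rowBound , E₁-rowBound , W₁-bound
  , commutation ββinv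
  , (λ i _ → D₁-mulᵛ V₁ i)
  , (λ j 1≤j → trans (W₁-mulˡ E₁ j) (E₁-first-row j 1≤j))
  where
    open CommutativeRing R using (trans)
    open PaperMatrices R αinv β βinv q
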